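{- Let $G=(V,E)$ be a finite undirected graph and let $(i,j)\in E$ be a weak edge of $G$. Define $\Delta_{ij}=\{k : (i,k)\in E \text{ and } (j,k)\in E\}$, $D_i=\{s\in V : (i,s)\in E,\ s\neq j,\ s\notin\Delta_{ij}\}$ and $D_j=\{t\in V : (j,t)\in E,\ t\neq i,\ t\notin\Delta_{ij}\}$. Let $G^{(i,j)}$ be the graph obtained from $G$ by deleting all vertices of $\Delta_{ij}$ together with their incident edges, adding an edge between each $s\in D_i$ and each $t\in D_j$ whenever such an edge is not already present, and deleting the vertices $i$ and $j$ together with their incident edges. Let $R\subseteq V(G^{(i,j)})$ and define $$R^*=\begin{cases} R\cup\Delta_{ij}\cup\{j\}, & \text{if } D_i\subseteq R,\\ R\cup\Delta_{ij}\cup\{i\}, & \text{otherwise}.\end{cases}$$ Then: (1) if $R$ is a vertex cover of $G^{(i,j)}$, then $R^*$ is a vertex cover of $G$; (2) if $R$ is an optimal vertex cover of $G^{(i,j)}$, then $R^*$ is an optimal vertex cover of $G$; (3) for any $\gamma\ge 1$, if $R$ is a $\gamma$-optimal vertex cover of $G^{(i,j)}$, then $R^*$ is a $\gamma$-optimal vertex cover of $G$.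
   Context: A vertex cover of an undirected graph $H$ is a set $S$ of vertices such that every edge of $H$ has at least one endpoint in $S$; it is optimal if it has minimum cardinality. For $\gamma\ge1$, a vertex cover $S$ of $H$ is $\gamma$-optimal if $|S|\le\gamma|S^0|$ where $S^0$ is an optimal vertex cover of $H$. An edge $(i,j)$ of $G$ is a weak edge if there exists an optimal vertex cover $V^0$ of $G$ with $|V^0\cap\{i,j\}|=1$.
   Formalization: The parameter γ in part (3) ranges over the rationals. -}

module Defs where

open import Data.Nat using (ℕ; _≤_)
open import Data.Bool using (Bool; true; false; _∧_; _∨_; not; if_then_else_)
open import Data.Fin using (Fin; _≟_)
open import Data.Fin.Subset using (Subset; _∈_; _∉_; _⊆_; _∪_; ⁅_⁆; ∣_∣)
open import Data.Fin.Subset.Properties using (_⊆?_)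
open import Data.Vec using (tabulate; lookup)
open import Data.Product using (_×_; ∃)
open import Data.Sum using (_⊎_)
open import Data.Integer using (+_)
import Data.Rational as ℚ
open import Relation.Nullary.Decidable using (⌊_⌋)
open import Relation.Binary.PropositionalEquality using (_≡_)

-- A graph whose vertex set V is a subset of Fin n; the edge relation is
-- given by a Boolean adjacency function (only its values on V matter).
record Graph (n : ℕ) : Set where
  constructor mkGraph
  field
    V   : Subset n
    adj : Fin n → Fin n → Bool

open Graph public

Edge : ∀ {n} → Graph n → Fin n → Fin n → Set
Edge G u v = adj G u v ≡ true

record IsSimple {n : ℕ} (G : Graph n) : Set where
  field
    adj-sym    : ∀ u v → adj G u v ≡ adj G v u
    adj-irrefl : ∀ v → adj G v v ≡ false
    adj-inV    : ∀ u v → Edge G u v → u ∈ V G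

VertexCover : ∀ {n} → Graph n → Subset n → Set
VertexCover G S = S ⊆ V G × (∀ u v → Edge G u v → u ∈ S ⊎ v ∈ S)

OptimalVertexCover : ∀ {n} → Graph n → Subset n → Set
OptimalVertexCover G S =
  VertexCover G S × (∀ T → VertexCover G T → ∣ S ∣ ≤ ∣ T ∣)

ℕ→ℚ : ℕ → ℚ.ℚ
ℕ→ℚ m = (+ m) ℚ./ 1

GammaOptimalVertexCover : ∀ {n} → Graph n → ℚ.ℚ → Subset n → Set
GammaOptimalVertexCover G γ S =
  VertexCover G S ×
  (∀ S⁰ → OptimalVertexCover G S⁰ → ℕ→ℚ ∣ S ∣ ℚ.≤ γ ℚ.* ℕ→ℚ ∣ S⁰ ∣)

WeakEdge : ∀ {n} → Graph n → Fin n → Fin n → Set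
WeakEdge G i j =
  Edge G i j ×
  ∃ λ V⁰ → OptimalVertexCover G V⁰ × ((i ∈ V⁰ × j ∉ V⁰) ⊎ (i ∉ V⁰ × j ∈ V⁰))

module _ {n : ℕ} (G : Graph n) (i j : Fin n) where

  Δ : Subset n
  Δ = tabulate λ k → adj G i k ∧ adj G j k

  Dᵢ : Subset n
  Dᵢ = tabulate λ s → adj G i s ∧ not ⌊ s ≟ j ⌋ ∧ not (lookup Δ s)

  Dⱼ : Subset n
  Dⱼ = tabulate λ t → adj G j t ∧ not ⌊ t ≟ i ⌋ ∧ not (lookup Δ t)

  Vᵢⱼ : Subset n
  Vᵢⱼ = tabulate λ v → lookup (V G) v ∧ not (lookup Δ v)
                         ∧ not ⌊ v ≟ i ⌋ ∧ not ⌊ v ≟ j ⌋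

  reduced : Graph n
  reduced = mkGraph Vᵢⱼ λ u v →
    lookup Vᵢⱼ u ∧ lookup Vᵢⱼ v ∧
    (adj G u v ∨ (lookup Dᵢ u ∧ lookup Dⱼ v) ∨ (lookup Dⱼ u ∧ lookup Dᵢ v))

  lift : Subset n → Subset n
  lift R = if ⌊ Dᵢ ⊆? R ⌋ then R ∪ Δ ∪ ⁅ j ⁆ else R ∪ Δ ∪ ⁅ i ⁆

-- Put k = ∣Δᵢⱼ∣ + 1. If R covers G^(i,j), then R* adds Δᵢⱼ and one endpoint a of the edge ij,
-- and every neighbour of the other endpoint b that survives in G^(i,j) already lies in R; hence
-- R* covers G, and it has exactly ∣R∣ + k vertices. Conversely, the optimal cover S witnessing
-- that ij is weak contains exactly one endpoint, so it contains every neighbour of the other one,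
-- in particular Δᵢⱼ; its restriction to G^(i,j) is then a cover with at most ∣S∣ - k vertices.
-- Thus the minimum cover sizes satisfy τ(G) = τ(G^(i,j)) + k, which transfers optimality, and
-- γ-optimality because γ ≥ 1 absorbs the additive constant k.
module Submission where

open import Defs
open import Level using (Level)
open import Data.Nat as ℕ using (ℕ; suc; _+_)
import Data.Nat.Properties as ℕP
open import Data.Nat.Coprimality as Coprime using (1-coprimeTo)
import Data.Integer as ℤ
import Data.Integer.Properties as ℤP
open import Data.Rational as ℚ using (ℚ; mkℚ; *≤*; 1ℚ)
import Data.Rational.Properties as ℚP
open import Data.Bool using (Bool; true; false; _∧_; _∨_; not)
open import Data.Bool.Properties using (∧-conicalˡ; ∧-conicalʳ; not-injective; not-¬; ¬-not)
open import Data.Fin using (Fin; _≟_)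
open import Data.Fin.Subset using (Subset; _∈_; _∉_; _⊆_; _∪_; _∩_; ⁅_⁆; ∣_∣; inside; outside)
open import Data.Fin.Subset.Properties
  using (_∈?_; _⊆?_; x∈p∪q⁺; x∈p∪q⁻; x∈p∩q⁺; p∩q⊆p; p∩q⊆q; x∈⁅x⁆; x∈⁅y⁆⇒x≡y; ∣⁅x⁆∣≡1; p⊆q⇒∣p∣≤∣q∣)
open import Data.Vec using ([]; _∷_; lookup; tabulate; here; there)
open import Data.Vec.Properties using (lookup∘tabulate; []=⇒lookup; lookup⇒[]=)
open import Data.Product using (_×_; _,_; proj₁; proj₂; ∃; ∃₂; swap)
open import Data.Product.Function.NonDependent.Propositional using (_×-⇔_)
open import Data.Sum as Sum using (_⊎_; inj₁; inj₂)
open import Data.Sum.Function.Propositional using (_⊎-⇔_)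
open import Function using (_∘′_; _⇔_; mk⇔; Equivalence)
open import Function.Construct.Composition using (_⇔-∘_)
open import Function.Construct.Identity using (⇔-id)
open import Data.Empty using (⊥-elim)
open import Relation.Nullary using (¬_; Dec; yes; no; contradiction)
open import Relation.Nullary.Decidable using (⌊_⌋)
open import Relation.Binary.PropositionalEquality

open Equivalence using (to; from)

private variable
  ℓ ℓ′ : Level
  A : Set ℓ
  B : Set ℓ′
  n : ℕ
  s t : Bool
  x : Fin n
  p q : Subset n

∧≡true⇔ : s ∧ t ≡ true ⇔ (s ≡ true × t ≡ true)
∧≡true⇔ {s} {t} = mk⇔ (λ e → ∧-conicalˡ s t e , ∧-conicalʳ s t e) λ { (refl , refl) → refl }

∨≡true⇔ : s ∨ t ≡ true ⇔ (s ≡ true ⊎ t ≡ true)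
∨≡true⇔ {true}  = mk⇔ inj₁ (λ _ → refl)
∨≡true⇔ {false} = mk⇔ inj₂ λ { (inj₁ ()) ; (inj₂ e) → e }

∧-⇔ : s ≡ true ⇔ A → t ≡ true ⇔ B → s ∧ t ≡ true ⇔ (A × B)
∧-⇔ A⇔ B⇔ = (A⇔ ×-⇔ B⇔) ⇔-∘ ∧≡true⇔

∨-⇔ : s ≡ true ⇔ A → t ≡ true ⇔ B → s ∨ t ≡ true ⇔ (A ⊎ B)
∨-⇔ A⇔ B⇔ = (A⇔ ⊎-⇔ B⇔) ⇔-∘ ∨≡true⇔

not⌊⌋≡true⇔¬ : (a? : Dec A) → not ⌊ a? ⌋ ≡ true ⇔ (¬ A)
not⌊⌋≡true⇔¬ (yes a) = mk⇔ (λ ()) (contradiction a)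
not⌊⌋≡true⇔¬ (no ¬a) = mk⇔ (λ _ → ¬a) (λ _ → refl)

lookup≡true⇔∈ : lookup p x ≡ true ⇔ x ∈ p
lookup≡true⇔∈ {p = p} {x} = mk⇔ (lookup⇒[]= x p) []=⇒lookup

not-lookup≡true⇔∉ : not (lookup p x) ≡ true ⇔ x ∉ p
not-lookup≡true⇔∉ {p = p} {x} = mk⇔
  (λ e x∈p → not-¬ ([]=⇒lookup x∈p) (not-injective e))
  (λ x∉p → cong not (¬-not (x∉p ∘′ lookup⇒[]= x p)))

∈-tabulate⇔ : {f : Fin n → Bool} → x ∈ tabulate f ⇔ f x ≡ true
∈-tabulate⇔ {x = x} {f} = mk⇔
  (λ x∈ → trans (sym (lookup∘tabulate f x)) ([]=⇒lookup x∈))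
  (λ fx → lookup⇒[]= x _ (trans (lookup∘tabulate f x) fx))

∣p∪q∣≡∣p∣+∣q∣ : (∀ {x} → x ∈ p → x ∉ q) → ∣ p ∪ q ∣ ≡ ∣ p ∣ + ∣ q ∣
∣p∪q∣≡∣p∣+∣q∣ {p = []}          {[]}          _ = refl
∣p∪q∣≡∣p∣+∣q∣ {p = inside  ∷ p} {inside  ∷ q} disj = contradiction here (disj here)
∣p∪q∣≡∣p∣+∣q∣ {p = inside  ∷ p} {outside ∷ q} disj =
  cong suc (∣p∪q∣≡∣p∣+∣q∣ λ x∈p x∈q → disj (there x∈p) (there x∈q))
∣p∪q∣≡∣p∣+∣q∣ {p = outside ∷ p} {inside  ∷ q} disj =
  trans (cong suc (∣p∪q∣≡∣p∣+∣q∣ λ x∈p x∈q → disj (there x∈p) (there x∈q))) (sym (ℕP.+-suc ∣ p ∣ ∣ q ∣))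
∣p∪q∣≡∣p∣+∣q∣ {p = outside ∷ p} {outside ∷ q} disj =
  ∣p∪q∣≡∣p∣+∣q∣ λ x∈p x∈q → disj (there x∈p) (there x∈q)

ℕ→ℚ≡mkℚ : ∀ m → ℕ→ℚ m ≡ mkℚ (ℤ.+ m) 0 (Coprime.sym (1-coprimeTo m))
ℕ→ℚ≡mkℚ m = ℚP.normalize-coprime (Coprime.sym (1-coprimeTo m))

ℕ→ℚ-homo-+ : ∀ m k → ℕ→ℚ (m + k) ≡ ℕ→ℚ m ℚ.+ ℕ→ℚ k
ℕ→ℚ-homo-+ m k rewrite ℕ→ℚ≡mkℚ m | ℕ→ℚ≡mkℚ k =
  cong (ℚ._/ 1) (sym (cong₂ ℤ._+_ (ℤP.*-identityʳ (ℤ.+ m)) (ℤP.*-identityʳ (ℤ.+ k))))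

ℕ→ℚ-mono-≤ : ∀ {m k} → m ℕ.≤ k → ℕ→ℚ m ℚ.≤ ℕ→ℚ k
ℕ→ℚ-mono-≤ {m} {k} m≤k rewrite ℕ→ℚ≡mkℚ m | ℕ→ℚ≡mkℚ k =
  *≤* (subst₂ ℤ._≤_ (sym (ℤP.*-identityʳ (ℤ.+ m))) (sym (ℤP.*-identityʳ (ℤ.+ k))) (ℤ.+≤+ m≤k))

1≤⇒nonNegative : ∀ {γ} → 1ℚ ℚ.≤ γ → ℚ.NonNegative γ
1≤⇒nonNegative 1≤γ = ℚ.nonNegative (ℚP.≤-trans (ℚP.nonNegative⁻¹ 1ℚ) 1≤γ)

scaled-≤-+ : ∀ {γ} → 1ℚ ℚ.≤ γ → ∀ m n k →
             ℕ→ℚ m ℚ.≤ γ ℚ.* ℕ→ℚ n → ℕ→ℚ (m + k) ℚ.≤ γ ℚ.* ℕ→ℚ (n + k)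
scaled-≤-+ {γ} 1≤γ m n k m≤γn = begin
  ℕ→ℚ (m + k)                     ≡⟨ ℕ→ℚ-homo-+ m k ⟩
  ℕ→ℚ m ℚ.+ ℕ→ℚ k                 ≤⟨ ℚP.+-mono-≤ m≤γn k≤γk ⟩
  γ ℚ.* ℕ→ℚ n ℚ.+ γ ℚ.* ℕ→ℚ k     ≡⟨ ℚP.*-distribˡ-+ γ (ℕ→ℚ n) (ℕ→ℚ k) ⟨
  γ ℚ.* (ℕ→ℚ n ℚ.+ ℕ→ℚ k)         ≡⟨ cong (γ ℚ.*_) (ℕ→ℚ-homo-+ n k) ⟨
  γ ℚ.* ℕ→ℚ (n + k)               ∎
  where
  open ℚP.≤-Reasoning
  k≤γk : ℕ→ℚ k ℚ.≤ γ ℚ.* ℕ→ℚ k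
  k≤γk = subst (ℚ._≤ γ ℚ.* ℕ→ℚ k) (ℚP.*-identityˡ (ℕ→ℚ k))
           (ℚP.*-monoʳ-≤-nonNeg (ℕ→ℚ k) {{ℚP.normalize-nonNeg k 1}} 1≤γ)

cover-contains-neighbours : ∀ {G : Graph n} {S u v} →
  VertexCover G S → u ∉ S → Edge G u v → v ∈ S
cover-contains-neighbours {u = u} {v} (_ , covers) u∉S e =
  Sum.fromInj₂ (λ u∈S → contradiction u∈S u∉S) (covers u v e)

module _ (G : Graph n) (i j : Fin n) where

  ∈Δ⇔ : x ∈ Δ G i j ⇔ (Edge G i x × Edge G j x)
  ∈Δ⇔ = ∧≡true⇔ ⇔-∘ ∈-tabulate⇔

  ∈Dᵢ⇔ : x ∈ Dᵢ G i j ⇔ (Edge G i x × x ≢ j × x ∉ Δ G i j)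
  ∈Dᵢ⇔ {x = x} =
    ∧-⇔ (⇔-id _) (∧-⇔ (not⌊⌋≡true⇔¬ (x ≟ j)) not-lookup≡true⇔∉) ⇔-∘ ∈-tabulate⇔

  ∈Dⱼ⇔ : x ∈ Dⱼ G i j ⇔ (Edge G j x × x ≢ i × x ∉ Δ G i j)
  ∈Dⱼ⇔ {x = x} =
    ∧-⇔ (⇔-id _) (∧-⇔ (not⌊⌋≡true⇔¬ (x ≟ i)) not-lookup≡true⇔∉) ⇔-∘ ∈-tabulate⇔

  ∈Vᵢⱼ⇔ : x ∈ Vᵢⱼ G i j ⇔ (x ∈ V G × x ∉ Δ G i j × x ≢ i × x ≢ j)
  ∈Vᵢⱼ⇔ {x = x} =
    ∧-⇔ lookup≡true⇔∈ (∧-⇔ not-lookup≡true⇔∉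
      (∧-⇔ (not⌊⌋≡true⇔¬ (x ≟ i)) (not⌊⌋≡true⇔¬ (x ≟ j)))) ⇔-∘ ∈-tabulate⇔

  reduced-Edge⇔ : ∀ {u v} → Edge (reduced G i j) u v ⇔
    (u ∈ Vᵢⱼ G i j × v ∈ Vᵢⱼ G i j ×
     (Edge G u v ⊎ (u ∈ Dᵢ G i j × v ∈ Dⱼ G i j) ⊎ (u ∈ Dⱼ G i j × v ∈ Dᵢ G i j)))
  reduced-Edge⇔ =
    ∧-⇔ lookup≡true⇔∈ (∧-⇔ lookup≡true⇔∈ (∨-⇔ (⇔-id _)
      (∨-⇔ (∧-⇔ lookup≡true⇔∈ lookup≡true⇔∈) (∧-⇔ lookup≡true⇔∈ lookup≡true⇔∈))))

module Reduction {G : Graph n} (simple : IsSimple G) (i j : Fin n) where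
  open IsSimple simple

  private variable
    u v a b : Fin n
    R S : Subset n

  edge-sym : Edge G u v → Edge G v u
  edge-sym {u} {v} e = trans (adj-sym v u) e

  edge-irrefl : Edge G u v → u ≢ v
  edge-irrefl {u} e refl = contradiction (trans (sym e) (adj-irrefl u)) λ ()

  edge-inVʳ : Edge G u v → v ∈ V G
  edge-inVʳ e = adj-inV _ _ (edge-sym e)

  ∈Δ⇒∈V : x ∈ Δ G i j → x ∈ V G
  ∈Δ⇒∈V x∈Δ = edge-inVʳ (proj₁ (to (∈Δ⇔ G i j) x∈Δ))

  ∈Vᵢⱼ⇒∉Δ : x ∈ Vᵢⱼ G i j → x ∉ Δ G i j
  ∈Vᵢⱼ⇒∉Δ x∈V′ = proj₁ (proj₂ (to (∈Vᵢⱼ⇔ G i j) x∈V′))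

  Vᵢⱼ⊆V : Vᵢⱼ G i j ⊆ V G
  Vᵢⱼ⊆V x∈V′ = proj₁ (to (∈Vᵢⱼ⇔ G i j) x∈V′)

  Dᵢ⊆Vᵢⱼ : Dᵢ G i j ⊆ Vᵢⱼ G i j
  Dᵢ⊆Vᵢⱼ x∈Dᵢ with to (∈Dᵢ⇔ G i j) x∈Dᵢ
  ... | e , x≢j , x∉Δ = from (∈Vᵢⱼ⇔ G i j) (edge-inVʳ e , x∉Δ , edge-irrefl e ∘′ sym , x≢j)

  Dⱼ⊆Vᵢⱼ : Dⱼ G i j ⊆ Vᵢⱼ G i j
  Dⱼ⊆Vᵢⱼ x∈Dⱼ with to (∈Dⱼ⇔ G i j) x∈Dⱼ
  ... | e , x≢i , x∉Δ = from (∈Vᵢⱼ⇔ G i j) (edge-inVʳ e , x∉Δ , x≢i , edge-irrefl e ∘′ sym)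

  data Ends : Fin n → Fin n → Set where
    ij : Ends i j
    ji : Ends j i

  ends-edge : Edge G i j → Ends a b → Edge G a b
  ends-edge e ij = e
  ends-edge e ji = edge-sym e

  ∈Δ⇒adjacent : Ends a b → x ∈ Δ G i j → Edge G a x × Edge G b x
  ∈Δ⇒adjacent ij x∈Δ = to (∈Δ⇔ G i j) x∈Δ
  ∈Δ⇒adjacent ji x∈Δ = swap (to (∈Δ⇔ G i j) x∈Δ)

  ∈Vᵢⱼ⇒≢ends : Ends a b → x ∈ Vᵢⱼ G i j → x ≢ a × x ≢ b
  ∈Vᵢⱼ⇒≢ends ij x∈V′ = proj₂ (proj₂ (to (∈Vᵢⱼ⇔ G i j) x∈V′))
  ∈Vᵢⱼ⇒≢ends ji x∈V′ = swap (proj₂ (proj₂ (to (∈Vᵢⱼ⇔ G i j) x∈V′)))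

  D-edge-adjacent : Ends a b → u ∈ Dᵢ G i j → v ∈ Dⱼ G i j → Edge G b u ⊎ Edge G b v
  D-edge-adjacent ij _ v∈Dⱼ = inj₂ (proj₁ (to (∈Dⱼ⇔ G i j) v∈Dⱼ))
  D-edge-adjacent ji u∈Dᵢ _ = inj₁ (proj₁ (to (∈Dᵢ⇔ G i j) u∈Dᵢ))

  data Place (a b : Fin n) : Fin n → Set where
    at-a     : Place a b a
    at-b     : Place a b b
    in-Δ     : x ∈ Δ G i j → Place a b x
    in-Vᵢⱼ   : x ∈ Vᵢⱼ G i j → Place a b x

  place : Ends a b → x ∈ V G → Place a b x
  place {a} {b} {x} ends x∈V with x ≟ a | x ≟ b | x ∈? Δ G i j
  ... | yes refl | _        | _       = at-a
  ... | no _     | yes refl | _       = at-b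
  ... | no _     | no _     | yes x∈Δ = in-Δ x∈Δ
  ... | no x≢a   | no x≢b   | no x∉Δ  = in-Vᵢⱼ (from (∈Vᵢⱼ⇔ G i j) (x∈V , x∉Δ , ≢ends ends))
    where
    ≢ends : Ends a b → x ≢ i × x ≢ j
    ≢ends ij = x≢a , x≢b
    ≢ends ji = x≢b , x≢a

  extend : Fin n → Subset n → Subset n
  extend a R = R ∪ (Δ G i j ∪ ⁅ a ⁆)

  ∈-extend⁻ : x ∈ extend a R → x ∈ R ⊎ x ∈ Δ G i j ⊎ x ≡ a
  ∈-extend⁻ {a = a} {R} x∈ =
    Sum.map₂ (Sum.map₂ (x∈⁅y⁆⇒x≡y a) ∘′ x∈p∪q⁻ (Δ G i j) ⁅ a ⁆) (x∈p∪q⁻ R _ x∈)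

  R⊆extend : R ⊆ extend a R
  R⊆extend x∈R = x∈p∪q⁺ (inj₁ x∈R)

  Δ⊆extend : Δ G i j ⊆ extend a R
  Δ⊆extend x∈Δ = x∈p∪q⁺ (inj₂ (x∈p∪q⁺ (inj₁ x∈Δ)))

  a∈extend : a ∈ extend a R
  a∈extend {a} = x∈p∪q⁺ (inj₂ (x∈p∪q⁺ (inj₂ (x∈⁅x⁆ a))))

  extend-cover : Edge G i j → Ends a b → VertexCover (reduced G i j) R →
                 (∀ {x} → Edge G b x → x ∈ Vᵢⱼ G i j → x ∈ R) →
                 VertexCover G (extend a R)
  extend-cover {a} {b} {R} eᵢⱼ ends (R⊆V′ , R-covers) b-neighbours⊆R = ⊆V , covers
    where
    ⊆V : extend a R ⊆ V G
    ⊆V x∈ with ∈-extend⁻ x∈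
    ... | inj₁ x∈R         = Vᵢⱼ⊆V (R⊆V′ x∈R)
    ... | inj₂ (inj₁ x∈Δ)  = ∈Δ⇒∈V x∈Δ
    ... | inj₂ (inj₂ refl) = adj-inV a b (ends-edge eᵢⱼ ends)

    covers : ∀ u v → Edge G u v → u ∈ extend a R ⊎ v ∈ extend a R
    covers u v e with place ends (adj-inV u v e) | place ends (edge-inVʳ e)
    ... | at-a         | _            = inj₁ a∈extend
    ... | in-Δ u∈Δ     | _            = inj₁ (Δ⊆extend u∈Δ)
    ... | _            | at-a         = inj₂ a∈extend
    ... | _            | in-Δ v∈Δ     = inj₂ (Δ⊆extend v∈Δ)
    ... | at-b         | at-b         = contradiction refl (edge-irrefl e)
    ... | at-b         | in-Vᵢⱼ v∈V′  = inj₂ (R⊆extend (b-neighbours⊆R e v∈V′))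
    ... | in-Vᵢⱼ u∈V′  | at-b         = inj₁ (R⊆extend (b-neighbours⊆R (edge-sym e) u∈V′))
    ... | in-Vᵢⱼ u∈V′  | in-Vᵢⱼ v∈V′ =
      Sum.map R⊆extend R⊆extend (R-covers u v (from (reduced-Edge⇔ G i j) (u∈V′ , v∈V′ , inj₁ e)))

  ∣extend∣ : Ends a b → R ⊆ Vᵢⱼ G i j → ∣ extend a R ∣ ≡ ∣ R ∣ + (∣ Δ G i j ∣ + 1)
  ∣extend∣ {a} {b} {R} ends R⊆V′ = begin
    ∣ extend a R ∣                      ≡⟨ ∣p∪q∣≡∣p∣+∣q∣ R-disjoint ⟩
    ∣ R ∣ + ∣ Δ G i j ∪ ⁅ a ⁆ ∣         ≡⟨ cong (∣ R ∣ +_) (∣p∪q∣≡∣p∣+∣q∣ Δ-disjoint) ⟩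
    ∣ R ∣ + (∣ Δ G i j ∣ + ∣ ⁅ a ⁆ ∣)   ≡⟨ cong (λ m → ∣ R ∣ + (∣ Δ G i j ∣ + m)) (∣⁅x⁆∣≡1 a) ⟩
    ∣ R ∣ + (∣ Δ G i j ∣ + 1)           ∎
    where
    open ≡-Reasoning
    Δ-disjoint : x ∈ Δ G i j → x ∉ ⁅ a ⁆
    Δ-disjoint x∈Δ x∈⁅a⁆ with x∈⁅y⁆⇒x≡y a x∈⁅a⁆
    ... | refl = edge-irrefl (proj₁ (∈Δ⇒adjacent ends x∈Δ)) refl
    R-disjoint : x ∈ R → x ∉ Δ G i j ∪ ⁅ a ⁆
    R-disjoint x∈R x∈ with x∈p∪q⁻ (Δ G i j) ⁅ a ⁆ x∈
    ... | inj₁ x∈Δ    = ∈Vᵢⱼ⇒∉Δ (R⊆V′ x∈R) x∈Δ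
    ... | inj₂ x∈⁅a⁆ = proj₁ (∈Vᵢⱼ⇒≢ends ends (R⊆V′ x∈R)) (x∈⁅y⁆⇒x≡y a x∈⁅a⁆)

  -- The reduced graph joins all of Dᵢ to all of Dⱼ, so a vertex of Dⱼ outside R forces Dᵢ ⊆ R.
  Dᵢ⊈R⇒Dⱼ⊆R : VertexCover (reduced G i j) R → ¬ (Dᵢ G i j ⊆ R) → Dⱼ G i j ⊆ R
  Dᵢ⊈R⇒Dⱼ⊆R {R} R-cover Dᵢ⊈R {t} t∈Dⱼ with t ∈? R
  ... | yes t∈R = t∈R
  ... | no  t∉R = ⊥-elim (Dᵢ⊈R Dᵢ⊆R)
    where
    Dᵢ⊆R : Dᵢ G i j ⊆ R
    Dᵢ⊆R s∈Dᵢ = cover-contains-neighbours R-cover t∉R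
      (from (reduced-Edge⇔ G i j) (Dⱼ⊆Vᵢⱼ t∈Dⱼ , Dᵢ⊆Vᵢⱼ s∈Dᵢ , inj₂ (inj₂ (t∈Dⱼ , s∈Dᵢ))))

  lift-decomposes : VertexCover (reduced G i j) R →
    ∃₂ λ a b → Ends a b × lift G i j R ≡ extend a R ×
               (∀ {x} → Edge G b x → x ∈ Vᵢⱼ G i j → x ∈ R)
  lift-decomposes {R} R-cover with Dᵢ G i j ⊆? R
  ... | yes Dᵢ⊆R = j , i , ji , refl , λ e x∈V′ → Dᵢ⊆R (neighbour∈Dᵢ e x∈V′)
    where
    neighbour∈Dᵢ : Edge G i x → x ∈ Vᵢⱼ G i j → x ∈ Dᵢ G i j
    neighbour∈Dᵢ e x∈V′ with to (∈Vᵢⱼ⇔ G i j) x∈V′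
    ... | _ , x∉Δ , _ , x≢j = from (∈Dᵢ⇔ G i j) (e , x≢j , x∉Δ)
  ... | no Dᵢ⊈R = i , j , ij , refl , λ e x∈V′ → Dᵢ⊈R⇒Dⱼ⊆R R-cover Dᵢ⊈R (neighbour∈Dⱼ e x∈V′)
    where
    neighbour∈Dⱼ : Edge G j x → x ∈ Vᵢⱼ G i j → x ∈ Dⱼ G i j
    neighbour∈Dⱼ e x∈V′ with to (∈Vᵢⱼ⇔ G i j) x∈V′
    ... | _ , x∉Δ , x≢i , _ = from (∈Dⱼ⇔ G i j) (e , x≢i , x∉Δ)

  lift-cover : Edge G i j → VertexCover (reduced G i j) R → VertexCover G (lift G i j R)
  lift-cover eᵢⱼ R-cover with lift-decomposes R-cover
  ... | _ , _ , ends , lift≡ , b-neighbours⊆R =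
    subst (VertexCover G) (sym lift≡) (extend-cover eᵢⱼ ends R-cover b-neighbours⊆R)

  ∣lift∣ : VertexCover (reduced G i j) R → ∣ lift G i j R ∣ ≡ ∣ R ∣ + (∣ Δ G i j ∣ + 1)
  ∣lift∣ R-cover@(R⊆V′ , _) with lift-decomposes R-cover
  ... | _ , _ , ends , lift≡ , _ = trans (cong ∣_∣ lift≡) (∣extend∣ ends R⊆V′)

  restrict-cover : Ends a b → VertexCover G S → b ∉ S →
                   VertexCover (reduced G i j) (S ∩ Vᵢⱼ G i j)
  restrict-cover {a} {b} {S} ends S-cover b∉S = p∩q⊆q S (Vᵢⱼ G i j) , covers
    where
    b-neighbour∈S : Edge G b x → x ∈ S
    b-neighbour∈S = cover-contains-neighbours S-cover b∉S

    covers : ∀ u v → Edge (reduced G i j) u v → u ∈ S ∩ Vᵢⱼ G i j ⊎ v ∈ S ∩ Vᵢⱼ G i j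
    covers u v e with to (reduced-Edge⇔ G i j) e
    ... | u∈V′ , v∈V′ , edge = Sum.map (x∈p∩q⁺ ∘′ (_, u∈V′)) (x∈p∩q⁺ ∘′ (_, v∈V′)) (covered edge)
      where
      covered : Edge G u v ⊎ (u ∈ Dᵢ G i j × v ∈ Dⱼ G i j) ⊎ (u ∈ Dⱼ G i j × v ∈ Dᵢ G i j) →
                u ∈ S ⊎ v ∈ S
      covered (inj₁ e′)                  = proj₂ S-cover u v e′
      covered (inj₂ (inj₁ (u∈Dᵢ , v∈Dⱼ))) =
        Sum.map b-neighbour∈S b-neighbour∈S (D-edge-adjacent ends u∈Dᵢ v∈Dⱼ)
      covered (inj₂ (inj₂ (u∈Dⱼ , v∈Dᵢ))) =
        Sum.swap (Sum.map b-neighbour∈S b-neighbour∈S (D-edge-adjacent ends v∈Dᵢ u∈Dⱼ))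

  ∣restrict∣+∣Δ∣+1≤ : Ends a b → VertexCover G S → a ∈ S → b ∉ S →
                     ∣ S ∩ Vᵢⱼ G i j ∣ + (∣ Δ G i j ∣ + 1) ℕ.≤ ∣ S ∣
  ∣restrict∣+∣Δ∣+1≤ {a} {b} {S} ends S-cover a∈S b∉S =
    subst (ℕ._≤ ∣ S ∣) (∣extend∣ ends (p∩q⊆q S (Vᵢⱼ G i j))) (p⊆q⇒∣p∣≤∣q∣ extend⊆S)
    where
    extend⊆S : extend a (S ∩ Vᵢⱼ G i j) ⊆ S
    extend⊆S x∈ with ∈-extend⁻ x∈
    ... | inj₁ x∈S∩V′      = p∩q⊆p S (Vᵢⱼ G i j) x∈S∩V′
    ... | inj₂ (inj₁ x∈Δ)  = cover-contains-neighbours S-cover b∉S (proj₂ (∈Δ⇒adjacent ends x∈Δ))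
    ... | inj₂ (inj₂ refl) = a∈S

  separated-ends : (i ∈ S × j ∉ S) ⊎ (i ∉ S × j ∈ S) → ∃₂ λ a b → Ends a b × a ∈ S × b ∉ S
  separated-ends (inj₁ (i∈S , j∉S)) = i , j , ij , i∈S , j∉S
  separated-ends (inj₂ (i∉S , j∈S)) = j , i , ji , j∈S , i∉S

  weak-edge⇒optimal-restriction : WeakEdge G i j →
    ∃ λ R₀ → OptimalVertexCover (reduced G i j) R₀ ×
             (∀ T → VertexCover G T → ∣ R₀ ∣ + (∣ Δ G i j ∣ + 1) ℕ.≤ ∣ T ∣)
  weak-edge⇒optimal-restriction (eᵢⱼ , S , (S-cover , S-min) , separated)
    with separated-ends separated
  ... | a , b , ends , a∈S , b∉S =
    R₀ , (restrict-cover ends S-cover b∉S , R₀-min) ,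
    λ T T-cover → ℕP.≤-trans R₀+k≤∣S∣ (S-min T T-cover)
    where
    k : ℕ
    k = ∣ Δ G i j ∣ + 1

    R₀ : Subset n
    R₀ = S ∩ Vᵢⱼ G i j

    R₀+k≤∣S∣ : ∣ R₀ ∣ + k ℕ.≤ ∣ S ∣
    R₀+k≤∣S∣ = ∣restrict∣+∣Δ∣+1≤ ends S-cover a∈S b∉S

    R₀-min : ∀ Q → VertexCover (reduced G i j) Q → ∣ R₀ ∣ ℕ.≤ ∣ Q ∣
    R₀-min Q Q-cover = ℕP.+-cancelʳ-≤ k ∣ R₀ ∣ ∣ Q ∣ (begin
      ∣ R₀ ∣ + k          ≤⟨ R₀+k≤∣S∣ ⟩
      ∣ S ∣               ≤⟨ S-min _ (lift-cover eᵢⱼ Q-cover) ⟩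
      ∣ lift G i j Q ∣    ≡⟨ ∣lift∣ Q-cover ⟩
      ∣ Q ∣ + k           ∎)
      where open ℕP.≤-Reasoning

lemma2 : ∀ {n} (G : Graph n) → IsSimple G → (i j : Fin n) → WeakEdge G i j →
         (R : Subset n) →
         (VertexCover (reduced G i j) R → VertexCover G (lift G i j R)) ×
         (OptimalVertexCover (reduced G i j) R →
            OptimalVertexCover G (lift G i j R)) ×
         (∀ (γ : ℚ.ℚ) → ℚ.1ℚ ℚ.≤ γ →
            GammaOptimalVertexCover (reduced G i j) γ R →
            GammaOptimalVertexCover G γ (lift G i j R))
lemma2 G simple i j weak@(eᵢⱼ , _) R
  with Reduction.weak-edge⇒optimal-restriction simple i j weak
... | R₀ , R₀-optimal@(R₀-cover , _) , R₀+k≤ = lift-cover eᵢⱼ , lift-optimal , lift-γ-optimal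
  where
  open Reduction simple i j

  k : ℕ
  k = ∣ Δ G i j ∣ + 1

  lift-optimal : OptimalVertexCover (reduced G i j) R → OptimalVertexCover G (lift G i j R)
  lift-optimal (R-cover , R-min) = lift-cover eᵢⱼ R-cover , λ T T-cover → begin
    ∣ lift G i j R ∣  ≡⟨ ∣lift∣ R-cover ⟩
    ∣ R ∣ + k         ≤⟨ ℕP.+-monoˡ-≤ k (R-min R₀ R₀-cover) ⟩
    ∣ R₀ ∣ + k        ≤⟨ R₀+k≤ T T-cover ⟩
    ∣ T ∣             ∎
    where open ℕP.≤-Reasoning

  lift-γ-optimal : ∀ γ → 1ℚ ℚ.≤ γ → GammaOptimalVertexCover (reduced G i j) γ R →
                   GammaOptimalVertexCover G γ (lift G i j R)
  lift-γ-optimal γ 1≤γ (R-cover , R-approx) = lift-cover eᵢⱼ R-cover , λ S S-optimal → begin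
    ℕ→ℚ ∣ lift G i j R ∣     ≡⟨ cong ℕ→ℚ (∣lift∣ R-cover) ⟩
    ℕ→ℚ (∣ R ∣ + k)          ≤⟨ scaled-≤-+ 1≤γ ∣ R ∣ ∣ R₀ ∣ k (R-approx R₀ R₀-optimal) ⟩
    γ ℚ.* ℕ→ℚ (∣ R₀ ∣ + k)   ≤⟨ ℚP.*-monoˡ-≤-nonNeg γ {{1≤⇒nonNegative 1≤γ}}
                                  (ℕ→ℚ-mono-≤ (R₀+k≤ S (proj₁ S-optimal))) ⟩
    γ ℚ.* ℕ→ℚ ∣ S ∣          ∎
    where open ℚP.≤-Reasoning
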